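{- Let $p$ be a prime, $g\in\mathbb F_p[x_1,\dots,x_n]^{m_g}$ and $h\in\mathbb F_p[x_1,\dots,x_n]^{m_h}$ two systems of polynomials, and $f=(g,h)$. If there exists a permutation $\sigma\in S_n$ of order $p$ such that (1) $\mathcal M_g=\emptyset$ and (2) $\langle\sigma\rangle$ acts freely on $\mathcal V_g\cap\overline{\mathcal V_h}$, then $|\mathcal V_f|\equiv0\pmod p$.
   Context: For a system $f=(f_1,\dots,f_m)$, $\mathcal V_f=\{x\in\mathbb F_p^n:f_i(x)=0\ \forall i\}$ and $\overline{\mathcal V_f}=\mathbb F_p^n\setminus\mathcal V_f$. The expansion into monic monomials of $P\in\mathbb F_p[x]$ writes $P=\sum_\alpha c_\alpha x^\alpha$ with $c_\alpha\in\{0,\dots,p-1\}$ and lists $x^\alpha$ exactly $c_\alpha$ times. For a system $g=(g_1,\dots,g_{m})$ let $\mathrm{CW}_{g_i}=1-g_i^{p-1}$ with expansion $\sum_{\ell=1}^{r_i}t_{i,\ell}$; for $S\in[r_1]\times\dots\times[r_m]$, $t_S=\prod_i t_{i,s_i}$ is max-degree if $t_S\equiv\prod_{j=1}^nx_j^{p-1}$ modulo the ideal generated by $\{x_j^p-x_j\}_j$, and $\mathcal M_g$ is the set of $S$ with $t_S$ max-degree. For $\sigma\in S_n$, $\sigma(x)$ permutes the coordinates of $x$ according to $\sigma$, and $\langle\sigma\rangle$ acts freely on $\mathcal V\subseteq\mathbb F_p^n$ if $\sigma(x)\in\mathcal V$ and $\sigma(x)\neq x$ for every $x\in\mathcal V$.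 -}

module Defs where

open import Data.Nat using (ℕ; zero; suc; _+_; _*_; _∸_; _^_; _≤?_; _≤_; _<_; NonZero)
open import Data.Nat.DivMod using (_%_)
open import Data.Nat.Divisibility using (_∣_; _∣?_)
open import Data.Nat.Properties using () renaming (_≟_ to _≟ℕ_)
open import Data.Fin using (Fin; toℕ)
open import Data.Fin.Permutation using (Permutation′; _⟨$⟩ʳ_; _⟨$⟩ˡ_)
open import Data.Vec using (Vec; []; _∷_; zipWith; replicate; lookup; _++_)
open import Data.Vec.Properties using (≡-dec)
open import Data.List using (List; []; _∷_; map; concatMap; deduplicate; filter; length)
open import Data.Nat.ListAction using (sum)
import Data.List as L
open import Data.List.Relation.Unary.All using (All)
open import Data.Product using (_×_; _,_; Σ; proj₁; proj₂)
open import Relation.Nullary using (¬_; yes; no; Dec)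
open import Relation.Binary.PropositionalEquality using (_≡_; _≢_)
import Data.Vec.Relation.Unary.All as VAll

-- Polynomials in F_p[x_1,…,x_n], represented as formal sums of terms
-- c · x^α  (c : ℕ read modulo p, α : exponent vector).  Every polynomial
-- over F_p has such a representation; all notions below (coefficients
-- mod p, expansion, evaluation) depend only on the polynomial itself.

Monomial : ℕ → Set
Monomial n = Vec ℕ n

Poly : ℕ → Set
Poly n = List (ℕ × Monomial n)

one : (n : ℕ) → Poly n
one n = (1 , replicate n 0) ∷ []

scale : {n : ℕ} → ℕ → Poly n → Poly n
scale c = map (λ t → c * proj₁ t , proj₂ t)

_·_ : {n : ℕ} → Poly n → Poly n → Poly n
P · Q = concatMap (λ t → map (λ s → proj₁ t * proj₁ s , zipWith _+_ (proj₂ t) (proj₂ s)) Q) P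

pow : {n : ℕ} → Poly n → ℕ → Poly n
pow {n} P zero = one n
pow P (suc k) = P · pow P k

-- CW_P = 1 - P^(p-1)   (subtraction = adding (p-1) times, since coefficients are mod p)
CW : (p : ℕ) {n : ℕ} → Poly n → Poly n
CW p {n} P = one n L.++ scale (p ∸ 1) (pow P (p ∸ 1))

coeff : (p : ℕ) .{{_ : NonZero p}} {n : ℕ} → Poly n → Monomial n → ℕ
coeff p P α = sum (map proj₁ (filter (λ t → ≡-dec _≟ℕ_ (proj₂ t) α) P)) % p

expansion : (p : ℕ) .{{_ : NonZero p}} {n : ℕ} → Poly n → List (Monomial n)
expansion p P = concatMap (λ α → L.replicate (coeff p P α) α)
                          (deduplicate (≡-dec _≟ℕ_) (map proj₂ P))

-- Reduction of exponents modulo x^p - x : repeatedly replace x^p by x,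
-- i.e. e ↦ e - (p-1) while e ≥ p.  (Fuel e suffices when p ≥ 2.)

redFuel : ℕ → ℕ → ℕ → ℕ
redFuel zero p e = e
redFuel (suc k) p e with p ≤? e
... | yes _ = redFuel k p (e ∸ (p ∸ 1))
... | no _ = e

redExp : ℕ → ℕ → ℕ
redExp p e = redFuel e p e

-- x^α ≡ ∏_j x_j^(p-1) modulo the ideal (x_j^p - x_j)_j
IsMaxDeg : (p : ℕ) {n : ℕ} → Monomial n → Set
IsMaxDeg p α = VAll.All (λ e → redExp p e ≡ p ∸ 1) α

monProd : {n m : ℕ} → (Fin m → Monomial n) → Monomial n
monProd {n} {zero} t = replicate n 0
monProd {n} {suc m} t = zipWith _+_ (t Data.Fin.zero) (monProd (λ i → t (Data.Fin.suc i)))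

Selection : (p : ℕ) .{{_ : NonZero p}} {n m : ℕ} → Vec (Poly n) m → Set
Selection p {m = m} g = (i : Fin m) → Fin (length (expansion p (CW p (lookup g i))))

tS : (p : ℕ) .{{_ : NonZero p}} {n m : ℕ} (g : Vec (Poly n) m) → Selection p g → Monomial n
tS p g S = monProd (λ i → L.lookup (expansion p (CW p (lookup g i))) (S i))

M : (p : ℕ) .{{_ : NonZero p}} {n m : ℕ} → Vec (Poly n) m → Set
M p g = Σ (Selection p g) (λ S → IsMaxDeg p (tS p g S))

Point : ℕ → ℕ → Set
Point p n = Vec (Fin p) n

evalMon : {p n : ℕ} → Monomial n → Point p n → ℕ
evalMon [] [] = 1
evalMon (a ∷ α) (x ∷ xs) = (toℕ x ^ a) * evalMon α xs

-- value of P at x, as a natural number (to be read modulo p)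
eval : {p n : ℕ} → Poly n → Point p n → ℕ
eval P x = sum (map (λ t → proj₁ t * evalMon (proj₂ t) x) P)

InV : {p n m : ℕ} → Vec (Poly n) m → Point p n → Set
InV {p} f x = VAll.All (λ P → p ∣ eval P x) f

InV? : {p n m : ℕ} (f : Vec (Poly n) m) (x : Point p n) → Dec (InV f x)
InV? {p} f x = VAll.all? (λ P → p ∣? eval P x) f

allPoints : (p n : ℕ) → List (Point p n)
allPoints p zero = [] ∷ []
allPoints p (suc n) = concatMap (λ a → map (a ∷_) (allPoints p n)) (L.allFin p)

card-V : (p : ℕ) {n m : ℕ} → Vec (Poly n) m → ℕ
card-V p f = length (filter (InV? f) (allPoints p _))

permPow : {n : ℕ} → Permutation′ n → ℕ → Fin n → Fin n
permPow σ zero i = i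
permPow σ (suc k) i = σ ⟨$⟩ʳ (permPow σ k i)

HasOrder : {n : ℕ} → Permutation′ n → ℕ → Set
HasOrder {n} σ k = ((i : Fin n) → permPow σ k i ≡ i)
                 × ((j : ℕ) → 1 ≤ j → j < k → ¬ ((i : Fin n) → permPow σ j i ≡ i))

act : {p n : ℕ} → Permutation′ n → Point p n → Point p n
act σ x = Data.Vec.tabulate (λ i → lookup x (σ ⟨$⟩ˡ i))

ActsFreely : {p n mg mh : ℕ} → Permutation′ n → Vec (Poly n) mg → Vec (Poly n) mh → Set
ActsFreely {p} {n} σ g h =
  (x : Point p n) → InV g x → ¬ InV h x →
    (InV g (act σ x) × ¬ InV h (act σ x)) × act σ x ≢ x

-- Write W = V_g ∖ V_h, so that |V_g| = |W| + |V_f|.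
--
-- By Fermat, CW_P(x) is 1 when P(x) = 0 and 0 otherwise, so modulo p the number |V_g| is
-- Σ_x ∏_i CW_{g_i}(x).  Expanding each CW_{g_i} into its monic monomials turns this into a sum,
-- over all selections S, of Σ_x t_S(x).  Such a sum factors into one-variable power sums
-- Σ_{a<p} a^e, and Σ_{a<p} a^e ≡ 0 unless e reduces to p − 1 modulo x^p − x.  Hence
-- Σ_x t_S(x) ≡ 0 unless t_S is max-degree, and M_g = ∅ gives p ∣ |V_g|.
--
-- Since σ has order p and ⟨σ⟩ acts freely on W, W is a disjoint union of σ-orbits of size exactly p,
-- so p ∣ |W|, and therefore p ∣ |V_f|.

module Submission where

open import Defs
open import Data.Nat
open import Data.Nat.Properties
open import Data.Nat.Properties using () renaming (_≟_ to _≟ℕ_)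
open import Data.Nat.Induction using (<-rec)
open import Data.Nat.DivMod
open import Data.Nat.Divisibility
open import Data.Nat.GeneralisedArithmetic using (fold; fold-+)
open import Data.Nat.Primality using (Prime; prime⇒nonZero; euclidsLemma; ¬prime[0]; ¬prime[1])
open import Data.Nat.Coprimality using (prime⇒coprime; coprime-Bézout)
open import Data.Nat.GCD using (module Bézout)
open import Data.Nat.Combinatorics using (_C_; nC1≡n; nCk+nC[k+1]≡[n+1]C[k+1]; nCk≡nC[n∸k]; nCn≡1)
open import Data.Nat.ListAction using (sum)
open import Data.Nat.Tactic.RingSolver using (solve-∀)
open import Data.Fin as Fin using (Fin; toℕ)
open import Data.Fin.Permutation using (Permutation′; _⟨$⟩ʳ_; _⟨$⟩ˡ_; inverseˡ)
open import Data.Vec as V using (Vec; []; _∷_; _++_; zipWith; lookup; tabulate)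
open import Data.Vec.Properties
  using (≡-dec; lookup∘tabulate; tabulate∘lookup; tabulate-cong; ∷-injective; zipWith-assoc; zipWith-identityʳ; zipWith-identityˡ)
import Data.Vec.Relation.Unary.All as VAll
open import Data.Vec.Relation.Unary.All.Properties using (++⁺; ++⁻)
open import Data.List as L using (List; []; _∷_; upTo; applyUpTo; allFin; length; filter)
open import Data.List.Properties using (map-upTo; map-applyUpTo; upTo-∷ʳ; map-tabulate; length-applyUpTo)
open import Data.List.Relation.Unary.All using (All; []; _∷_)
import Data.List.Relation.Unary.All as All
import Data.List.Relation.Unary.All.Properties as Allₚ
open import Data.List.Relation.Unary.Any using (here; there)
import Data.List.Relation.Unary.Any as Any
open import Data.List.Relation.Unary.Any.Properties using (lookup-index)
open import Data.List.Relation.Unary.Unique.Propositional using (Unique; []; _∷_)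
import Data.List.Relation.Unary.Unique.Propositional.Properties as Uniqueₚ
open import Data.List.Relation.Unary.Unique.DecPropositional.Properties using (deduplicate-!)
open import Data.List.Membership.Propositional using (_∈_; _∉_)
open import Data.List.Membership.Propositional.Properties
  using (∈-applyUpTo⁺; ∈-applyUpTo⁻; ∈-map⁺; ∈-deduplicate⁺; ∈-allFin)
open import Data.Product using (_×_; _,_; proj₁; proj₂; Σ; ∃)
open import Data.Sum using (_⊎_; inj₁; inj₂)
open import Function.Base using (_∘_)
open import Function.Bundles using (_⇔_; mk⇔; Equivalence)
open import Level using (0ℓ)
open import Relation.Nullary using (¬_; yes; no; Dec; contradiction)
open import Relation.Nullary.Decidable using (¬?; _×-dec_)
open import Relation.Binary.Bundles using (Setoid)
open import Relation.Binary.Definitions using (DecidableEquality)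
open import Relation.Binary.PropositionalEquality
import Relation.Binary.Reasoning.Setoid as SetoidReasoning
open import Algebra.Bundles using (CommutativeSemiring)
import Algebra.Properties.CommutativeSemiring.Binomial as Binomial
import Algebra.Properties.Semiring.Exp as SemiringExp
import Algebra.Definitions.RawMonoid as RawMonoid
import Algebra.Properties.CommutativeSemigroup as CommSemigroupProperties

open CommSemigroupProperties +-commutativeSemigroup using () renaming (interchange to +-interchange)
open CommSemigroupProperties *-commutativeSemigroup using () renaming (interchange to *-interchange)

private
  variable
    A B : Set
    b n : ℕ

∑∈ : List A → (A → ℕ) → ℕ
∑∈ xs f = sum (L.map f xs)

syntax ∑∈ xs (λ x → e) = ∑[ x ∈ xs ] e

∑-++ : ∀ (xs ys : List A) (f : A → ℕ) → ∑[ x ∈ xs L.++ ys ] f x ≡ ∑[ x ∈ xs ] f x + ∑[ x ∈ ys ] f x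
∑-++ [] ys f = refl
∑-++ (x ∷ xs) ys f = trans (cong (f x +_) (∑-++ xs ys f)) (sym (+-assoc (f x) _ _))

∑-cong : ∀ (xs : List A) {f g : A → ℕ} → (∀ x → f x ≡ g x) → ∑[ x ∈ xs ] f x ≡ ∑[ x ∈ xs ] g x
∑-cong [] e = refl
∑-cong (x ∷ xs) e = cong₂ _+_ (e x) (∑-cong xs e)

∑-cong-∈ : ∀ (xs : List A) {f g : A → ℕ} → (∀ {x} → x ∈ xs → f x ≡ g x) →
           ∑[ x ∈ xs ] f x ≡ ∑[ x ∈ xs ] g x
∑-cong-∈ [] e = refl
∑-cong-∈ (x ∷ xs) e = cong₂ _+_ (e (here refl)) (∑-cong-∈ xs (λ x∈xs → e (there x∈xs)))

∑-zero : ∀ (xs : List A) {f : A → ℕ} → (∀ x → f x ≡ 0) → ∑[ x ∈ xs ] f x ≡ 0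
∑-zero [] e = refl
∑-zero (x ∷ xs) e = cong₂ _+_ (e x) (∑-zero xs e)

∑-distrib-+ : ∀ (xs : List A) (f g : A → ℕ) →
              ∑[ x ∈ xs ] (f x + g x) ≡ ∑[ x ∈ xs ] f x + ∑[ x ∈ xs ] g x
∑-distrib-+ [] f g = refl
∑-distrib-+ (x ∷ xs) f g = trans (cong (f x + g x +_) (∑-distrib-+ xs f g)) (+-interchange (f x) (g x) _ _)

*-distribˡ-∑ : ∀ (xs : List A) c (f : A → ℕ) → ∑[ x ∈ xs ] (c * f x) ≡ c * ∑[ x ∈ xs ] f x
*-distribˡ-∑ [] c f = sym (*-zeroʳ c)
*-distribˡ-∑ (x ∷ xs) c f rewrite *-distribˡ-∑ xs c f = sym (*-distribˡ-+ c (f x) _)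

*-distribʳ-∑ : ∀ (xs : List A) c (f : A → ℕ) → ∑[ x ∈ xs ] (f x * c) ≡ ∑[ x ∈ xs ] f x * c
*-distribʳ-∑ xs c f = trans (∑-cong xs (λ x → *-comm (f x) c)) (trans (*-distribˡ-∑ xs c f) (*-comm c _))

∑-map : ∀ (xs : List A) (h : A → B) (f : B → ℕ) → ∑[ y ∈ L.map h xs ] f y ≡ ∑[ x ∈ xs ] f (h x)
∑-map [] h f = refl
∑-map (x ∷ xs) h f = cong (f (h x) +_) (∑-map xs h f)

∑-concatMap : ∀ (xs : List A) (h : A → List B) (f : B → ℕ) →
              ∑[ y ∈ L.concatMap h xs ] f y ≡ ∑[ x ∈ xs ] ∑[ y ∈ h x ] f y
∑-concatMap [] h f = refl
∑-concatMap (x ∷ xs) h f = trans (∑-++ (h x) _ f) (cong (∑[ y ∈ h x ] f y +_) (∑-concatMap xs h f))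

∑-replicate : ∀ k (a : A) (f : A → ℕ) → ∑[ x ∈ L.replicate k a ] f x ≡ k * f a
∑-replicate zero a f = refl
∑-replicate (suc k) a f = cong (f a +_) (∑-replicate k a f)

∑-comm : ∀ (xs : List A) (ys : List B) (f : A → B → ℕ) →
         ∑[ x ∈ xs ] ∑[ y ∈ ys ] f x y ≡ ∑[ y ∈ ys ] ∑[ x ∈ xs ] f x y
∑-comm [] ys f = sym (∑-zero ys (λ _ → refl))
∑-comm (x ∷ xs) ys f = trans (cong (∑[ y ∈ ys ] f x y +_) (∑-comm xs ys f))
                             (sym (∑-distrib-+ ys (f x) (λ y → ∑[ x ∈ xs ] f x y)))

∣-∑ : ∀ {d} {xs : List A} {f : A → ℕ} → All (λ x → d ∣ f x) xs → d ∣ ∑[ x ∈ xs ] f x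
∣-∑ {d = d} [] = d ∣0
∣-∑ (dx ∷ dxs) = ∣m∣n⇒∣m+n dx (∣-∑ dxs)

∑-upTo-suc : ∀ n (g : ℕ → ℕ) → ∑[ k ∈ upTo (suc n) ] g k ≡ g 0 + ∑[ k ∈ upTo n ] g (suc k)
∑-upTo-suc n g = cong (λ ks → g 0 + sum ks) (trans (map-applyUpTo suc g n) (sym (map-upTo (g ∘ suc) n)))

∑-upTo-∷ʳ : ∀ n (g : ℕ → ℕ) → ∑[ k ∈ upTo (suc n) ] g k ≡ ∑[ k ∈ upTo n ] g k + g n
∑-upTo-∷ʳ n g = begin
  ∑[ k ∈ upTo (suc n) ] g k           ≡⟨ cong (λ ks → ∑[ k ∈ ks ] g k) (upTo-∷ʳ n) ⟨
  ∑[ k ∈ upTo n L.++ L.[ n ] ] g k    ≡⟨ ∑-++ (upTo n) L.[ n ] g ⟩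
  ∑[ k ∈ upTo n ] g k + (g n + 0)     ≡⟨ cong (∑[ k ∈ upTo n ] g k +_) (+-identityʳ (g n)) ⟩
  ∑[ k ∈ upTo n ] g k + g n           ∎
  where open ≡-Reasoning

∑-allFin : ∀ n (g : ℕ → ℕ) → ∑[ i ∈ allFin n ] g (toℕ i) ≡ ∑[ k ∈ upTo n ] g k
∑-allFin zero g = refl
∑-allFin (suc n) g = begin
  g 0 + ∑[ i ∈ L.tabulate {n = n} Fin.suc ] g (toℕ i)
    ≡⟨ cong (λ ks → g 0 + sum ks) (map-tabulate {n = n} Fin.suc (g ∘ toℕ)) ⟩
  g 0 + sum (L.tabulate (λ (i : Fin n) → g (suc (toℕ i))))
    ≡⟨ cong (λ ks → g 0 + sum ks) (sym (map-tabulate {n = n} (λ i → i) (λ i → g (suc (toℕ i))))) ⟩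
  g 0 + ∑[ i ∈ allFin n ] g (suc (toℕ i))
    ≡⟨ cong (g 0 +_) (∑-allFin n (λ k → g (suc k))) ⟩
  g 0 + ∑[ k ∈ upTo n ] g (suc k)
    ≡⟨ sym (∑-upTo-suc n g) ⟩
  ∑[ k ∈ upTo (suc n) ] g k ∎
  where open ≡-Reasoning

𝟙 : {P : Set} → Dec P → ℕ
𝟙 (yes _) = 1
𝟙 (no _) = 0

𝟙-cong : {P Q : Set} (P? : Dec P) (Q? : Dec Q) → P ⇔ Q → 𝟙 P? ≡ 𝟙 Q?
𝟙-cong (yes _) (yes _) _ = refl
𝟙-cong (yes p) (no ¬q) P⇔Q = contradiction (Equivalence.to P⇔Q p) ¬q
𝟙-cong (no ¬p) (yes q) P⇔Q = contradiction (Equivalence.from P⇔Q q) ¬p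
𝟙-cong (no _) (no _) _ = refl

𝟙-yes : {P : Set} (P? : Dec P) → P → 𝟙 P? ≡ 1
𝟙-yes (yes _) _ = refl
𝟙-yes (no ¬p) p = contradiction p ¬p

𝟙-× : {P Q : Set} (P? : Dec P) (Q? : Dec Q) → 𝟙 (P? ×-dec Q?) ≡ 𝟙 P? * 𝟙 Q?
𝟙-× (yes _) (yes _) = refl
𝟙-× (yes _) (no _) = refl
𝟙-× (no _) _ = refl

𝟙-disjoint-∪ : {P Q R : Set} (P? : Dec P) (Q? : Dec Q) (R? : Dec R) →
               P ⇔ (Q ⊎ R) → (Q → ¬ R) → 𝟙 P? ≡ 𝟙 Q? + 𝟙 R?
𝟙-disjoint-∪ (yes _) (yes q) (yes r) _ Q∩R = contradiction r (Q∩R q)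
𝟙-disjoint-∪ (yes _) (yes _) (no _) _ _ = refl
𝟙-disjoint-∪ (yes _) (no _) (yes _) _ _ = refl
𝟙-disjoint-∪ (yes p) (no ¬q) (no ¬r) P⇔Q∪R _ with Equivalence.to P⇔Q∪R p
... | inj₁ q = contradiction q ¬q
... | inj₂ r = contradiction r ¬r
𝟙-disjoint-∪ (no ¬p) (yes q) _ P⇔Q∪R _ = contradiction (Equivalence.from P⇔Q∪R (inj₁ q)) ¬p
𝟙-disjoint-∪ (no ¬p) (no _) (yes r) P⇔Q∪R _ = contradiction (Equivalence.from P⇔Q∪R (inj₂ r)) ¬p
𝟙-disjoint-∪ (no _) (no _) (no _) _ _ = refl

count : {P : A → Set} → (∀ x → Dec (P x)) → List A → ℕ
count P? xs = ∑[ x ∈ xs ] 𝟙 (P? x)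

length-filter : {P : A → Set} (P? : ∀ x → Dec (P x)) (xs : List A) → length (filter P? xs) ≡ count P? xs
length-filter P? [] = refl
length-filter P? (x ∷ xs) with P? x
... | yes _ = cong suc (length-filter P? xs)
... | no _ = length-filter P? xs

count-disjoint-∪ : {P Q R : A → Set} (P? : ∀ x → Dec (P x)) (Q? : ∀ x → Dec (Q x)) (R? : ∀ x → Dec (R x)) →
                   (∀ {x} → P x ⇔ (Q x ⊎ R x)) → (∀ {x} → Q x → ¬ R x) →
                   ∀ xs → count P? xs ≡ count Q? xs + count R? xs
count-disjoint-∪ P? Q? R? P⇔Q∪R Q∩R xs =
  trans (∑-cong xs (λ x → 𝟙-disjoint-∪ (P? x) (Q? x) (R? x) P⇔Q∪R Q∩R)) (∑-distrib-+ xs _ _)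

count≢0⇒∃ : {P : A → Set} (P? : ∀ x → Dec (P x)) (xs : List A) → count P? xs ≢ 0 → ∃ P
count≢0⇒∃ P? [] c≢0 = contradiction refl c≢0
count≢0⇒∃ P? (x ∷ xs) c≢0 with P? x
... | yes px = x , px
... | no _ = count≢0⇒∃ P? xs c≢0

∑-1≡length : (xs : List A) → ∑[ x ∈ xs ] 1 ≡ length xs
∑-1≡length [] = refl
∑-1≡length (x ∷ xs) = cong suc (∑-1≡length xs)

module _ (_≟_ : DecidableEquality A) where

  open import Data.List.Membership.DecPropositional _≟_ using (_∈?_)

  count-≟ : ∀ {ys} → Unique ys → ∀ z → count (z ≟_) ys ≡ 𝟙 (z ∈? ys)
  count-≟ [] z = refl
  count-≟ {y ∷ ys} (y∉ys ∷ ys!) z with z ≟ y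
  ... | yes refl = cong suc (trans (count-≟ ys! z) (𝟙-cong (z ∈? ys) (no λ ()) (mk⇔ (Allₚ.All¬⇒¬Any y∉ys) λ ())))
  ... | no z≢y = trans (count-≟ ys! z) (𝟙-cong (z ∈? ys) _ (mk⇔ there λ { (here z≡y) → contradiction z≡y z≢y
                                                                       ; (there z∈ys) → z∈ys }))

  Enumerates : List A → Set
  Enumerates xs = ∀ z → count (z ≟_) xs ≡ 1

  count-∈-unique : ∀ {xs ys} → Enumerates xs → Unique ys → count (_∈? ys) xs ≡ length ys
  count-∈-unique {xs} {ys} enum ys! = begin
    ∑[ x ∈ xs ] 𝟙 (x ∈? ys)
      ≡⟨ ∑-cong xs (λ x → sym (count-≟ ys! x)) ⟩
    ∑[ x ∈ xs ] ∑[ y ∈ ys ] 𝟙 (x ≟ y)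
      ≡⟨ ∑-comm xs ys _ ⟩
    ∑[ y ∈ ys ] ∑[ x ∈ xs ] 𝟙 (x ≟ y)
      ≡⟨ ∑-cong ys (λ y → ∑-cong xs (λ x → 𝟙-cong (x ≟ y) (y ≟ x) (mk⇔ sym sym))) ⟩
    ∑[ y ∈ ys ] count (y ≟_) xs
      ≡⟨ ∑-cong ys enum ⟩
    ∑[ y ∈ ys ] 1
      ≡⟨ ∑-1≡length ys ⟩
    length ys ∎
    where open ≡-Reasoning

-- Free actions of a cyclic group of prime order

module FreeAction {X : Set} (_≟_ : DecidableEquality X) {xs : List X} (enum : Enumerates _≟_ xs)
                  {p : ℕ} (prime : Prime p) (τ : X → X) (τ^p≡id : ∀ x → fold x τ p ≡ x) where

  open import Data.List.Membership.DecPropositional _≟_ using (_∈?_)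

  τ^ : ℕ → X → X
  τ^ k x = fold x τ k

  τ^-* : ∀ k {d x} → τ^ d x ≡ x → τ^ (k * d) x ≡ x
  τ^-* zero _ = refl
  τ^-* (suc k) {d} {x} τ^dx≡x = begin
    τ^ (d + k * d) x    ≡⟨ fold-+ x τ d ⟩
    τ^ d (τ^ (k * d) x) ≡⟨ cong (τ^ d) (τ^-* k τ^dx≡x) ⟩
    τ^ d x              ≡⟨ τ^dx≡x ⟩
    x                   ∎
    where open ≡-Reasoning

  private
    0<p : 0 < p
    0<p = >-nonZero⁻¹ p {{prime⇒nonZero prime}}

    p-1+1≡p : p ∸ 1 + 1 ≡ p
    p-1+1≡p = m∸n+n≡m 0<p

    p-1<p : p ∸ 1 < p
    p-1<p = subst (p ∸ 1 <_) p-1+1≡p (m<m+n (p ∸ 1) (s≤s z≤n))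

  τ^[p-1]∘τ≡id : ∀ x → τ^ (p ∸ 1) (τ x) ≡ x
  τ^[p-1]∘τ≡id x = trans (sym (fold-+ x τ (p ∸ 1))) (trans (cong (λ k → τ^ k x) p-1+1≡p) (τ^p≡id x))

  τ-injective : ∀ {x y} → τ x ≡ τ y → x ≡ y
  τ-injective {x} {y} τx≡τy =
    trans (sym (τ^[p-1]∘τ≡id x)) (trans (cong (τ^ (p ∸ 1)) τx≡τy) (τ^[p-1]∘τ≡id y))

  orbit : X → List X
  orbit x = applyUpTo (λ k → τ^ k x) p

  ∈-orbit-τ⁻¹ : ∀ {x y} → τ y ∈ orbit x → y ∈ orbit x
  ∈-orbit-τ⁻¹ {x} {y} τy∈ with ∈-applyUpTo⁻ (λ k → τ^ k x) τy∈
  ... | zero , _ , τy≡x = subst (_∈ orbit x) (trans (cong (τ^ (p ∸ 1)) (sym τy≡x)) (τ^[p-1]∘τ≡id y))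
                                (∈-applyUpTo⁺ (λ k → τ^ k x) p-1<p)
  ... | suc k , k+1<p , τy≡τ[τ^kx] = subst (_∈ orbit x) (sym (τ-injective τy≡τ[τ^kx]))
                                             (∈-applyUpTo⁺ (λ k → τ^ k x) (<-trans (n<1+n k) k+1<p))

  module _ {W : X → Set} (W? : ∀ x → Dec (W x)) (free : ∀ x → W x → W (τ x) × τ x ≢ x) where

    τ^-closed : ∀ k {x} → W x → W (τ^ k x)
    τ^-closed zero wx = wx
    τ^-closed (suc k) wx = proj₁ (free _ (τ^-closed k wx))

    -- From a Bézout identity 1 + b d = a p (or 1 + a p = b d), τ^d x = x would force τ x = x.
    τ^-no-fixed-point : ∀ {x d} → W x → 0 < d → d < p → τ^ d x ≢ x
    τ^-no-fixed-point {x} {d} wx 0<d d<p τ^dx≡x with coprime-Bézout (prime⇒coprime prime {{>-nonZero 0<d}} d<p)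
    ... | Bézout.+- a b eq = proj₂ (free x wx) (begin
      τ x              ≡⟨ cong τ (τ^-* b τ^dx≡x) ⟨
      τ^ (1 + b * d) x ≡⟨ cong (λ k → τ^ k x) eq ⟩
      τ^ (a * p) x     ≡⟨ τ^-* a (τ^p≡id x) ⟩
      x                ∎)
      where open ≡-Reasoning
    ... | Bézout.-+ a b eq = proj₂ (free x wx) (begin
      τ x              ≡⟨ cong τ (τ^-* a (τ^p≡id x)) ⟨
      τ^ (1 + a * p) x ≡⟨ cong (λ k → τ^ k x) eq ⟩
      τ^ (b * d) x     ≡⟨ τ^-* b τ^dx≡x ⟩
      x                ∎)
      where open ≡-Reasoning

    orbit-unique : ∀ {x} → W x → Unique (orbit x)
    orbit-unique {x} wx = Uniqueₚ.applyUpTo⁺₁ _ p λ {i} {j} i<j j<p τ^ix≡τ^jx →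
      τ^-no-fixed-point (τ^-closed i wx) (m<n⇒0<n∸m i<j) (≤-<-trans (m∸n≤m j i) j<p) (begin
        τ^ (j ∸ i) (τ^ i x) ≡⟨ fold-+ x τ (j ∸ i) ⟨
        τ^ (j ∸ i + i) x    ≡⟨ cong (λ k → τ^ k x) (m∸n+n≡m (<⇒≤ i<j)) ⟩
        τ^ j x              ≡⟨ τ^ix≡τ^jx ⟨
        τ^ i x              ∎)
      where open ≡-Reasoning

    orbit⊆W : ∀ {x y} → W x → y ∈ orbit x → W y
    orbit⊆W {x} wx y∈ with ∈-applyUpTo⁻ (λ k → τ^ k x) y∈
    ... | k , _ , refl = τ^-closed k wx

    module _ {x₀ : X} (w₀ : W x₀) where

      Outside : X → Set
      Outside y = W y × y ∉ orbit x₀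

      Outside? : ∀ y → Dec (Outside y)
      Outside? y = W? y ×-dec ¬? (y ∈? orbit x₀)

      count-W≡count-Outside+p : count W? xs ≡ count Outside? xs + p
      count-W≡count-Outside+p = begin
        count W? xs
          ≡⟨ count-disjoint-∪ W? Outside? (_∈? orbit x₀) (mk⇔ split join) proj₂ xs ⟩
        count Outside? xs + count (_∈? orbit x₀) xs
          ≡⟨ cong (count Outside? xs +_) (count-∈-unique _≟_ {xs} enum (orbit-unique w₀)) ⟩
        count Outside? xs + length (orbit x₀)
          ≡⟨ cong (count Outside? xs +_) (length-applyUpTo _ p) ⟩
        count Outside? xs + p ∎
        where
        open ≡-Reasoning
        split : ∀ {y} → W y → Outside y ⊎ y ∈ orbit x₀
        split {y} wy with y ∈? orbit x₀
        ... | yes y∈ = inj₂ y∈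
        ... | no y∉ = inj₁ (wy , y∉)
        join : ∀ {y} → Outside y ⊎ y ∈ orbit x₀ → W y
        join (inj₁ (wy , _)) = wy
        join (inj₂ y∈) = orbit⊆W w₀ y∈

      free-Outside : ∀ y → Outside y → Outside (τ y) × τ y ≢ y
      free-Outside y (wy , y∉) = (proj₁ (free y wy) , λ τy∈ → y∉ (∈-orbit-τ⁻¹ τy∈)) , proj₂ (free y wy)

  private
    p∣count-free-≤ : ∀ n {W : X → Set} (W? : ∀ x → Dec (W x)) → (∀ x → W x → W (τ x) × τ x ≢ x) →
                     count W? xs ≤ n → p ∣ count W? xs
    p∣count-free-≤ zero W? free c≤0 = subst (p ∣_) (sym (n≤0⇒n≡0 c≤0)) (p ∣0)
    p∣count-free-≤ (suc n) W? free c≤1+n with count W? xs ≟ℕ 0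
    ... | yes c≡0 = subst (p ∣_) (sym c≡0) (p ∣0)
    ... | no c≢0 = subst (p ∣_) (sym count-W)
                     (∣m∣n⇒∣m+n (p∣count-free-≤ n (Outside? W? free w₀) (free-Outside W? free w₀) c'≤n) ∣-refl)
      where
      w₀ = proj₂ (count≢0⇒∃ W? xs c≢0)
      count-W = count-W≡count-Outside+p W? free w₀
      c' = count (Outside? W? free w₀) xs
      c'≤n : c' ≤ n
      c'≤n = s≤s⁻¹ (≤-trans (m<m+n c' 0<p) (subst (_≤ suc n) count-W c≤1+n))

  p∣count-free : ∀ {W : X → Set} (W? : ∀ x → Dec (W x)) → (∀ x → W x → W (τ x) × τ x ≢ x) →
                 p ∣ count W? xs
  p∣count-free W? free = p∣count-free-≤ _ W? free ≤-refl

-- Binomial coefficients and power sums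

private
  module ℕ-Semiring = CommutativeSemiring +-*-commutativeSemiring
  open SemiringExp ℕ-Semiring.semiring using () renaming (_^_ to _^ₛ_)
  open RawMonoid ℕ-Semiring.+-rawMonoid using () renaming (_×_ to _×ₛ_; sum to sumₛ)

  ^ₛ≡^ : ∀ x n → x ^ₛ n ≡ x ^ n
  ^ₛ≡^ x zero = refl
  ^ₛ≡^ x (suc n) = cong (x *_) (^ₛ≡^ x n)

  ×ₛ≡* : ∀ n x → n ×ₛ x ≡ n * x
  ×ₛ≡* zero x = refl
  ×ₛ≡* (suc n) x = cong (x +_) (×ₛ≡* n x)

  sumₛ≡∑ : ∀ n {f : Fin n → ℕ} (g : ℕ → ℕ) → (∀ i → f i ≡ g (toℕ i)) → sumₛ f ≡ ∑[ k ∈ upTo n ] g k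
  sumₛ≡∑ zero g _ = refl
  sumₛ≡∑ (suc n) g f≗g = trans (cong₂ _+_ (f≗g Fin.zero) (sumₛ≡∑ n (λ k → g (suc k)) (λ i → f≗g (Fin.suc i))))
                               (sym (∑-upTo-suc n g))

binomial : ∀ n x y → (x + y) ^ n ≡ ∑[ k ∈ upTo (suc n) ] ((n C k) * (x ^ k * y ^ (n ∸ k)))
binomial n x y = begin
  (x + y) ^ n
    ≡⟨ ^ₛ≡^ (x + y) n ⟨
  (x + y) ^ₛ n
    ≡⟨ Binomial.theorem +-*-commutativeSemiring n x y ⟩
  sumₛ {suc n} (λ k → (n C toℕ k) ×ₛ (x ^ₛ toℕ k * y ^ₛ (n ∸ toℕ k)))
    ≡⟨ sumₛ≡∑ (suc n) _ term≡ ⟩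
  ∑[ k ∈ upTo (suc n) ] ((n C k) * (x ^ k * y ^ (n ∸ k))) ∎
  where
  open ≡-Reasoning
  term≡ : ∀ k → (n C toℕ k) ×ₛ (x ^ₛ toℕ k * y ^ₛ (n ∸ toℕ k)) ≡ (n C toℕ k) * (x ^ toℕ k * y ^ (n ∸ toℕ k))
  term≡ k = trans (×ₛ≡* (n C toℕ k) _)
                  (cong ((n C toℕ k) *_) (cong₂ _*_ (^ₛ≡^ x (toℕ k)) (^ₛ≡^ y (n ∸ toℕ k))))

suc-*-C : ∀ n k → suc k * (suc n C suc k) ≡ suc n * (n C k)
suc-*-C zero zero = refl
suc-*-C zero (suc k) = *-zeroʳ (suc (suc k))
suc-*-C (suc n) zero = trans (+-identityʳ _) (trans (nC1≡n (suc (suc n))) (sym (*-identityʳ (suc (suc n)))))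
suc-*-C (suc n) (suc k) = begin
  suc (suc k) * (suc (suc n) C suc (suc k))
    ≡⟨ cong (suc (suc k) *_) (nCk+nC[k+1]≡[n+1]C[k+1] (suc n) (suc k)) ⟨
  suc (suc k) * (x + y)
    ≡⟨ expand k x y ⟩
  x + suc k * x + suc (suc k) * y
    ≡⟨ cong₂ (λ u v → x + u + v) (suc-*-C n k) (suc-*-C n (suc k)) ⟩
  x + suc n * (n C k) + suc n * (n C suc k)
    ≡⟨ collect n x (n C k) (n C suc k) ⟩
  x + suc n * (n C k + n C suc k)
    ≡⟨ cong (λ u → x + suc n * u) (nCk+nC[k+1]≡[n+1]C[k+1] n k) ⟩
  x + suc n * x ∎
  where
  open ≡-Reasoning
  x = suc n C suc k
  y = suc n C suc (suc k)
  expand : ∀ k x y → suc (suc k) * (x + y) ≡ x + suc k * x + suc (suc k) * y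
  expand = solve-∀
  collect : ∀ n z x y → z + suc n * x + suc n * y ≡ z + suc n * (x + y)
  collect = solve-∀

[1+n]C[n]≡1+n : ∀ n → suc n C n ≡ suc n
[1+n]C[n]≡1+n n = trans (nCk≡nC[n∸k] (n≤1+n n)) (trans (cong (suc n C_) (m+n∸n≡m 1 n)) (nC1≡n (suc n)))

powerSum : ℕ → ℕ → ℕ
powerSum N k = ∑[ a ∈ upTo N ] (a ^ k)

-- Expand ∑_{a<N} (a + 1)^(K+1) binomially; the sum telescopes to N^(K+1).
∑-C*powerSum : ∀ N K → ∑[ j ∈ upTo (suc K) ] ((suc K C j) * powerSum N j) ≡ N ^ suc K
∑-C*powerSum N K = +-cancelʳ-≡ (powerSum N m) _ _ (begin
  ∑[ j ∈ upTo m ] term j + powerSum N m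
    ≡⟨ cong (∑[ j ∈ upTo m ] term j +_) C[m,m]*S≡S ⟨
  ∑[ j ∈ upTo m ] term j + term m
    ≡⟨ ∑-upTo-∷ʳ m term ⟨
  ∑[ j ∈ upTo (suc m) ] term j
    ≡⟨ ∑-cong (upTo (suc m)) (λ j → *-distribˡ-∑ (upTo N) (m C j) (_^ j)) ⟨
  ∑[ j ∈ upTo (suc m) ] ∑[ a ∈ upTo N ] ((m C j) * a ^ j)
    ≡⟨ ∑-comm (upTo N) (upTo (suc m)) (λ a j → (m C j) * a ^ j) ⟨
  ∑[ a ∈ upTo N ] ∑[ j ∈ upTo (suc m) ] ((m C j) * a ^ j)
    ≡⟨ ∑-cong (upTo N) suc-binomial ⟨
  ∑[ a ∈ upTo N ] (suc a ^ m)
    ≡⟨ ∑-upTo-suc N (_^ m) ⟨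
  ∑[ a ∈ upTo (suc N) ] (a ^ m)
    ≡⟨ ∑-upTo-∷ʳ N (_^ m) ⟩
  powerSum N m + N ^ m
    ≡⟨ +-comm (powerSum N m) (N ^ m) ⟩
  N ^ m + powerSum N m ∎)
  where
  open ≡-Reasoning
  m = suc K
  term : ℕ → ℕ
  term j = (m C j) * powerSum N j
  C[m,m]*S≡S : term m ≡ powerSum N m
  C[m,m]*S≡S = trans (cong (_* powerSum N m) (nCn≡1 m)) (+-identityʳ _)
  suc-binomial : ∀ a → suc a ^ m ≡ ∑[ j ∈ upTo (suc m) ] ((m C j) * a ^ j)
  suc-binomial a = begin
    suc a ^ m
      ≡⟨ cong (_^ m) (+-comm 1 a) ⟩
    (a + 1) ^ m
      ≡⟨ binomial m a 1 ⟩
    ∑[ j ∈ upTo (suc m) ] ((m C j) * (a ^ j * 1 ^ (m ∸ j)))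
      ≡⟨ ∑-cong (upTo (suc m)) (λ j → cong (λ u → (m C j) * (a ^ j * u)) (^-zeroˡ (m ∸ j))) ⟩
    ∑[ j ∈ upTo (suc m) ] ((m C j) * (a ^ j * 1))
      ≡⟨ ∑-cong (upTo (suc m)) (λ j → cong ((m C j) *_) (*-identityʳ (a ^ j))) ⟩
    ∑[ j ∈ upTo (suc m) ] ((m C j) * a ^ j) ∎

module Congruence (p : ℕ) .{{_ : NonZero p}} where

  -- A record rather than a plain synonym for a % p ≡ b % p, so that a and b can be inferred.
  infix 4 _≈_
  record _≈_ (a b : ℕ) : Set where
    constructor mk≈
    field %-≡ : a % p ≡ b % p

  ≈-refl : ∀ {a} → a ≈ a
  ≈-refl = mk≈ refl

  ≈-reflexive : ∀ {a b} → a ≡ b → a ≈ b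
  ≈-reflexive refl = ≈-refl

  ≈-sym : ∀ {a b} → a ≈ b → b ≈ a
  ≈-sym (mk≈ e) = mk≈ (sym e)

  ≈-trans : ∀ {a b c} → a ≈ b → b ≈ c → a ≈ c
  ≈-trans (mk≈ e) (mk≈ f) = mk≈ (trans e f)

  ≈-setoid : Setoid 0ℓ 0ℓ
  ≈-setoid = record { _≈_ = _≈_ ; isEquivalence = record { refl = ≈-refl ; sym = ≈-sym ; trans = ≈-trans } }

  module ≈-Reasoning = SetoidReasoning ≈-setoid

  +-cong-≈ : ∀ {a b c d} → a ≈ b → c ≈ d → a + c ≈ b + d
  +-cong-≈ {a} {b} {c} {d} (mk≈ e₁) (mk≈ e₂) =
    mk≈ (trans (%-distribˡ-+ a c p) (trans (cong₂ (λ u v → (u + v) % p) e₁ e₂) (sym (%-distribˡ-+ b d p))))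

  *-cong-≈ : ∀ {a b c d} → a ≈ b → c ≈ d → a * c ≈ b * d
  *-cong-≈ {a} {b} {c} {d} (mk≈ e₁) (mk≈ e₂) =
    mk≈ (trans (%-distribˡ-* a c p) (trans (cong₂ (λ u v → (u * v) % p) e₁ e₂) (sym (%-distribˡ-* b d p))))

  ∑-cong-≈ : ∀ (xs : List A) {f g : A → ℕ} → (∀ x → f x ≈ g x) →
             ∑[ x ∈ xs ] f x ≈ ∑[ x ∈ xs ] g x
  ∑-cong-≈ [] _ = ≈-refl
  ∑-cong-≈ (x ∷ xs) f≈g = +-cong-≈ (f≈g x) (∑-cong-≈ xs f≈g)

  %-≈ : ∀ a → a % p ≈ a
  %-≈ a = mk≈ (m%n%n≡m%n a p)

  ∣⇒≈0 : ∀ {a} → p ∣ a → a ≈ 0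
  ∣⇒≈0 {a} p∣a = mk≈ (trans (n∣m⇒m%n≡0 a p p∣a) (sym (n∣m⇒m%n≡0 0 p (p ∣0))))

  ≈0⇒∣ : ∀ {a} → a ≈ 0 → p ∣ a
  ≈0⇒∣ {a} (mk≈ e) = m%n≡0⇒n∣m a p (trans e (n∣m⇒m%n≡0 0 p (p ∣0)))

  ∣-resp-≈ : ∀ {a b} → a ≈ b → p ∣ b → p ∣ a
  ∣-resp-≈ a≈b p∣b = ≈0⇒∣ (≈-trans a≈b (∣⇒≈0 p∣b))

  +-∣-≈ : ∀ a {d} → p ∣ d → a + d ≈ a
  +-∣-≈ a (divides k refl) = mk≈ ([m+kn]%n≡m%n a k p)

  ≈⇒∣∸ : ∀ {a b} → a ≤ b → a ≈ b → p ∣ b ∸ a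
  ≈⇒∣∸ {a} {b} a≤b (mk≈ e) = divides (b / p ∸ a / p) (begin
    b ∸ a                                     ≡⟨ cong₂ _∸_ (m≡m%n+[m/n]*n b p) (m≡m%n+[m/n]*n a p) ⟩
    (b % p + b / p * p) ∸ (a % p + a / p * p) ≡⟨ cong (λ r → (b % p + b / p * p) ∸ (r + a / p * p)) e ⟩
    (b % p + b / p * p) ∸ (b % p + a / p * p) ≡⟨ [m+n]∸[m+o]≡n∸o (b % p) (b / p * p) (a / p * p) ⟩
    b / p * p ∸ a / p * p                     ≡⟨ *-distribʳ-∸ p (b / p) (a / p) ⟨
    (b / p ∸ a / p) * p                       ∎)
    where open ≡-Reasoning

-- p is written 2 + q so that p ∸ 1, as it occurs in the definitions, reduces to 1 + q.
module PrimeModulus (q : ℕ) (prime : Prime (2 + q)) where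

  p : ℕ
  p = 2 + q

  open Congruence p public

  p∣k*a⇒p∣a : ∀ {k a} → 0 < k → k < p → p ∣ k * a → p ∣ a
  p∣k*a⇒p∣a {k} {a} 0<k k<p p∣ka with euclidsLemma k a prime p∣ka
  ... | inj₁ p∣k = contradiction p∣k (>⇒∤ {{>-nonZero 0<k}} k<p)
  ... | inj₂ p∣a = p∣a

  private
    cancel-≤ : ∀ {v a b} → ¬ p ∣ v → a ≤ b → b < p → v * a ≈ v * b → a ≡ b
    cancel-≤ {v} {a} {b} p∤v a≤b b<p va≈vb
      with euclidsLemma v (b ∸ a) prime (subst (p ∣_) (sym (*-distribˡ-∸ v b a)) (≈⇒∣∸ (*-monoʳ-≤ v a≤b) va≈vb))
    ... | inj₁ p∣v = contradiction p∣v p∤v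
    ... | inj₂ p∣b-a with b ∸ a ≟ 0
    ...   | yes b-a≡0 = ≤-antisym a≤b (m∸n≡0⇒m≤n b-a≡0)
    ...   | no b-a≢0 = contradiction p∣b-a (>⇒∤ {{≢-nonZero b-a≢0}} (≤-<-trans (m∸n≤m b a) b<p))

    cancel-< : ∀ {v a b} → ¬ p ∣ v → a < p → b < p → v * a ≈ v * b → a ≡ b
    cancel-< {a = a} {b} p∤v a<p b<p va≈vb with ≤-total a b
    ... | inj₁ a≤b = cancel-≤ p∤v a≤b b<p va≈vb
    ... | inj₂ b≤a = sym (cancel-≤ p∤v b≤a a<p (≈-sym va≈vb))

  *-cancelˡ-≈ : ∀ {v a b} → ¬ p ∣ v → v * a ≈ v * b → a ≈ b
  *-cancelˡ-≈ {v} {a} {b} p∤v va≈vb = mk≈ (cancel-< p∤v (m%n<n a p) (m%n<n b p)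
    (≈-trans (*-cong-≈ (≈-refl {v}) (%-≈ a)) (≈-trans va≈vb (*-cong-≈ (≈-refl {v}) (≈-sym (%-≈ b))))))

  p∣pC[1+j] : ∀ j → suc j < p → p ∣ p C suc j
  p∣pC[1+j] j 1+j<p = p∣k*a⇒p∣a (s≤s z≤n) 1+j<p (subst (p ∣_) (sym (suc-*-C (suc q) j)) (m∣m*n (suc q C j)))

  fermat : ∀ a → a ^ p ≈ a
  fermat zero = ≈-refl
  fermat (suc a) =
    ≈-trans (≈-reflexive split) (≈-trans (+-∣-≈ (1 + a ^ p) p∣middle) (+-cong-≈ (≈-refl {1}) (fermat a)))
    where
    term : ℕ → ℕ
    term k = (p C k) * (a ^ k * 1 ^ (p ∸ k))
    middle = ∑[ j ∈ upTo (suc q) ] term (suc j)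
    p∣middle : p ∣ middle
    p∣middle = ∣-∑ (Allₚ.applyUpTo⁺₁ (λ j → j) (suc q) λ {j} j<1+q → ∣m⇒∣m*n _ (p∣pC[1+j] j (s≤s j<1+q)))
    term0≡1 : term 0 ≡ 1
    term0≡1 = trans (+-identityʳ _) (trans (+-identityʳ _) (^-zeroˡ p))
    termp≡a^p : term p ≡ a ^ p
    termp≡a^p = trans (cong₂ (λ c e → c * (a ^ p * 1 ^ e)) (nCn≡1 p) (n∸n≡0 q))
                      (trans (+-identityʳ _) (*-identityʳ _))
    split : suc a ^ p ≡ 1 + a ^ p + middle
    split = begin
      suc a ^ p                              ≡⟨ cong (_^ p) (+-comm 1 a) ⟩
      (a + 1) ^ p                            ≡⟨ binomial p a 1 ⟩
      ∑[ k ∈ upTo (suc p) ] term k           ≡⟨ ∑-upTo-suc p term ⟩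
      term 0 + ∑[ j ∈ upTo p ] term (suc j)  ≡⟨ cong (term 0 +_) (∑-upTo-∷ʳ (suc q) (λ j → term (suc j))) ⟩
      term 0 + (middle + term p)             ≡⟨ cong₂ (λ u v → u + (middle + v)) term0≡1 termp≡a^p ⟩
      1 + (middle + a ^ p)                   ≡⟨ cong suc (+-comm middle (a ^ p)) ⟩
      1 + a ^ p + middle                     ∎
      where open ≡-Reasoning

  fermat-unit : ∀ {v} → ¬ p ∣ v → v ^ (p ∸ 1) ≈ 1
  fermat-unit {v} p∤v = *-cancelˡ-≈ p∤v (≈-trans (fermat v) (≈-reflexive (sym (*-identityʳ v))))

  -- Strong induction on K: the telescoping identity leaves (K + 1) · powerSum p K ≡ 0 modulo p.
  p∣powerSum : ∀ K → suc K < p → p ∣ powerSum p K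
  p∣powerSum = <-rec (λ K → suc K < p → p ∣ powerSum p K) step
    where
    step : ∀ K → (∀ {j} → j < K → suc j < p → p ∣ powerSum p j) → suc K < p → p ∣ powerSum p K
    step K ih 1+K<p =
      p∣k*a⇒p∣a (s≤s z≤n) 1+K<p (subst (p ∣_) (cong (_* powerSum p K) ([1+n]C[n]≡1+n K)) p∣last)
      where
      lower = ∑[ j ∈ upTo K ] ((suc K C j) * powerSum p j)
      p∣lower : p ∣ lower
      p∣lower = ∣-∑ (Allₚ.applyUpTo⁺₁ (λ j → j) K λ {j} j<K →
                       ∣n⇒∣m*n (suc K C j) (ih j<K (<-trans (s≤s j<K) 1+K<p)))
      p∣last : p ∣ (suc K C K) * powerSum p K
      p∣last = ∣m+n∣m⇒∣n (subst (p ∣_) (trans (sym (∑-C*powerSum p K)) (∑-upTo-∷ʳ K _)) (m∣m*n (p ^ K)))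
                         p∣lower

  ^-reduce : ∀ a {e} → p ≤ e → a ^ e ≈ a ^ (e ∸ (p ∸ 1))
  ^-reduce a {e} p≤e = begin
    a ^ e                 ≡⟨ cong (a ^_) (m∸n+n≡m p≤e) ⟨
    a ^ (e ∸ p + p)       ≡⟨ ^-distribˡ-+-* a (e ∸ p) p ⟩
    a ^ (e ∸ p) * a ^ p   ≈⟨ *-cong-≈ (≈-refl {a ^ (e ∸ p)}) (fermat a) ⟩
    a ^ (e ∸ p) * a       ≡⟨ *-comm (a ^ (e ∸ p)) a ⟩
    a ^ suc (e ∸ p)       ≡⟨ cong (a ^_) 1+[e∸p]≡e∸[p∸1] ⟩
    a ^ (e ∸ suc q)       ∎
    where
    open ≈-Reasoning
    1+[e∸p]≡e∸[p∸1] : suc (e ∸ p) ≡ e ∸ suc q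
    1+[e∸p]≡e∸[p∸1] = trans (cong suc (sym (pred[m∸n]≡m∸[1+n] e (suc q))))
                            (suc-pred (e ∸ suc q) {{>-nonZero (m<n⇒0<n∸m p≤e)}})

  ^-redFuel : ∀ k a e → a ^ e ≈ a ^ redFuel k p e
  ^-redFuel zero a e = ≈-refl
  ^-redFuel (suc k) a e with p ≤? e
  ... | yes p≤e = ≈-trans (^-reduce a p≤e) (^-redFuel k a (e ∸ suc q))
  ... | no _ = ≈-refl

  redFuel<p : ∀ k e → e < p + k → redFuel k p e < p
  redFuel<p zero e e<p+0 = subst (e <_) (+-identityʳ p) e<p+0
  redFuel<p (suc k) e e<p+1+k with p ≤? e
  ... | yes _ = redFuel<p k (e ∸ suc q)
                  (m<n+o⇒m∸n<o e (suc q)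
                    (<-≤-trans (subst (e <_) (+-suc p k) e<p+1+k) (+-monoˡ-≤ (p + k) (s≤s z≤n))))
  ... | no p≰e = ≰⇒> p≰e

  p∣powerSum-nonMax : ∀ e → redExp p e ≢ p ∸ 1 → p ∣ powerSum p e
  p∣powerSum-nonMax e r≢p-1 =
    ∣-resp-≈ (∑-cong-≈ (upTo p) (λ a → ^-redFuel e a e)) (p∣powerSum (redExp p e) 1+r<p)
    where
    1+r<p : suc (redExp p e) < p
    1+r<p = s≤s (≤∧≢⇒< (s≤s⁻¹ (redFuel<p e e (m<n+m e {p} (s≤s z≤n)))) r≢p-1)

evalMon-zipWith-+ : ∀ (α β : Monomial n) (x : Point b n) →
                    evalMon (zipWith _+_ α β) x ≡ evalMon α x * evalMon β x
evalMon-zipWith-+ [] [] [] = refl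
evalMon-zipWith-+ (a ∷ α) (b ∷ β) (t ∷ x) = begin
  toℕ t ^ (a + b) * evalMon (zipWith _+_ α β) x
    ≡⟨ cong₂ _*_ (^-distribˡ-+-* (toℕ t) a b) (evalMon-zipWith-+ α β x) ⟩
  toℕ t ^ a * toℕ t ^ b * (evalMon α x * evalMon β x)
    ≡⟨ *-interchange (toℕ t ^ a) (toℕ t ^ b) _ _ ⟩
  toℕ t ^ a * evalMon α x * (toℕ t ^ b * evalMon β x) ∎
  where open ≡-Reasoning

evalMon-0 : ∀ (x : Point b n) → evalMon (V.replicate n 0) x ≡ 1
evalMon-0 [] = refl
evalMon-0 (t ∷ x) = trans (+-identityʳ _) (evalMon-0 x)

eval-++ : ∀ (P Q : Poly n) (x : Point b n) → eval (P L.++ Q) x ≡ eval P x + eval Q x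
eval-++ P Q x = ∑-++ P Q _

eval-scale : ∀ c (P : Poly n) (x : Point b n) → eval (scale c P) x ≡ c * eval P x
eval-scale c P x = trans (∑-map P _ _) (trans (∑-cong P (λ t → *-assoc c (proj₁ t) _)) (*-distribˡ-∑ P c _))

eval-one : ∀ (x : Point b n) → eval (one n) x ≡ 1
eval-one x = cong (_+ 0) (trans (*-identityˡ _) (evalMon-0 x))

eval-·-term : ∀ c (α : Monomial n) (Q : Poly n) (x : Point b n) →
  eval (L.map (λ s → c * proj₁ s , zipWith _+_ α (proj₂ s)) Q) x ≡ c * evalMon α x * eval Q x
eval-·-term c α [] x = sym (*-zeroʳ (c * evalMon α x))
eval-·-term c α ((d , β) ∷ Q) x = begin
  c * d * evalMon (zipWith _+_ α β) x + eval (L.map _ Q) x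
    ≡⟨ cong₂ (λ u v → c * d * u + v) (evalMon-zipWith-+ α β x) (eval-·-term c α Q x) ⟩
  c * d * (evalMon α x * evalMon β x) + c * evalMon α x * eval Q x
    ≡⟨ regroup c d (evalMon α x) (evalMon β x) (eval Q x) ⟩
  c * evalMon α x * (d * evalMon β x + eval Q x) ∎
  where
  open ≡-Reasoning
  regroup : ∀ c d A B E → c * d * (A * B) + c * A * E ≡ c * A * (d * B + E)
  regroup = solve-∀

eval-· : ∀ (P Q : Poly n) (x : Point b n) → eval (P · Q) x ≡ eval P x * eval Q x
eval-· [] Q x = refl
eval-· ((c , α) ∷ P) Q x = begin
  eval (L.map _ Q L.++ P · Q) x
    ≡⟨ eval-++ (L.map _ Q) (P · Q) x ⟩
  eval (L.map _ Q) x + eval (P · Q) x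
    ≡⟨ cong₂ _+_ (eval-·-term c α Q x) (eval-· P Q x) ⟩
  c * evalMon α x * eval Q x + eval P x * eval Q x
    ≡⟨ *-distribʳ-+ (eval Q x) (c * evalMon α x) (eval P x) ⟨
  (c * evalMon α x + eval P x) * eval Q x ∎
  where open ≡-Reasoning

eval-pow : ∀ (P : Poly n) k (x : Point b n) → eval (pow P k) x ≡ eval P x ^ k
eval-pow P zero x = eval-one x
eval-pow P (suc k) x = trans (eval-· P (pow P k) x) (cong (eval P x *_) (eval-pow P k x))

eval-CW : ∀ r (P : Poly n) (x : Point b n) → eval (CW r P) x ≡ 1 + (r ∸ 1) * eval P x ^ (r ∸ 1)
eval-CW r P x = trans (eval-++ (one _) (scale (r ∸ 1) (pow P (r ∸ 1))) x)
  (cong₂ _+_ (eval-one x)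
             (trans (eval-scale (r ∸ 1) (pow P (r ∸ 1)) x) (cong ((r ∸ 1) *_) (eval-pow P (r ∸ 1) x))))

_≟ₘ_ : DecidableEquality (Monomial n)
_≟ₘ_ = ≡-dec _≟_

monomials : Poly n → List (Monomial n)
monomials P = L.deduplicate _≟ₘ_ (L.map proj₂ P)

rawCoeff : Poly n → Monomial n → ℕ
rawCoeff P α = sum (L.map proj₁ (L.filter (λ t → proj₂ t ≟ₘ α) P))

∑-expansion : ∀ p .{{_ : NonZero p}} (P : Poly n) (F : Monomial n → ℕ) →
              ∑[ β ∈ expansion p P ] F β ≡ ∑[ α ∈ monomials P ] (coeff p P α * F α)
∑-expansion p P F =
  trans (∑-concatMap (monomials P) _ F) (∑-cong (monomials P) (λ α → ∑-replicate (coeff p P α) α F))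

rawCoeff*F : ∀ (P : Poly n) α (F : Monomial n → ℕ) →
             rawCoeff P α * F α ≡ ∑[ t ∈ P ] (proj₁ t * F (proj₂ t) * 𝟙 (proj₂ t ≟ₘ α))
rawCoeff*F [] α F = refl
rawCoeff*F ((c , β) ∷ P) α F with β ≟ₘ α
... | yes refl = begin
  (c + rawCoeff P β) * F β                 ≡⟨ *-distribʳ-+ (F β) c (rawCoeff P β) ⟩
  c * F β + rawCoeff P β * F β             ≡⟨ cong₂ _+_ (sym (*-identityʳ (c * F β))) (rawCoeff*F P β F) ⟩
  c * F β * 1 + ∑[ t ∈ P ] (proj₁ t * F (proj₂ t) * 𝟙 (proj₂ t ≟ₘ β)) ∎
  where open ≡-Reasoning
... | no _ = trans (rawCoeff*F P α F)
                   (cong (_+ ∑[ t ∈ P ] (proj₁ t * F (proj₂ t) * 𝟙 (proj₂ t ≟ₘ α))) (sym (*-zeroʳ (c * F β))))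

∑-monomials-rawCoeff : ∀ (P : Poly n) (F : Monomial n → ℕ) →
                       ∑[ α ∈ monomials P ] (rawCoeff P α * F α) ≡ ∑[ t ∈ P ] (proj₁ t * F (proj₂ t))
∑-monomials-rawCoeff P F = begin
  ∑[ α ∈ monomials P ] (rawCoeff P α * F α)
    ≡⟨ ∑-cong (monomials P) (λ α → rawCoeff*F P α F) ⟩
  ∑[ α ∈ monomials P ] ∑[ t ∈ P ] (G t * 𝟙 (proj₂ t ≟ₘ α))
    ≡⟨ ∑-comm (monomials P) P _ ⟩
  ∑[ t ∈ P ] ∑[ α ∈ monomials P ] (G t * 𝟙 (proj₂ t ≟ₘ α))
    ≡⟨ ∑-cong P (λ t → *-distribˡ-∑ (monomials P) (G t) _) ⟩
  ∑[ t ∈ P ] (G t * count (proj₂ t ≟ₘ_) (monomials P))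
    ≡⟨ ∑-cong-∈ P (λ {t} t∈P → cong (G t *_) (count-once t∈P)) ⟩
  ∑[ t ∈ P ] (G t * 1)
    ≡⟨ ∑-cong P (λ t → *-identityʳ (G t)) ⟩
  ∑[ t ∈ P ] G t ∎
  where
  open ≡-Reasoning
  G : ℕ × Monomial _ → ℕ
  G t = proj₁ t * F (proj₂ t)
  count-once : ∀ {t} → t ∈ P → count (proj₂ t ≟ₘ_) (monomials P) ≡ 1
  count-once {t} t∈P = trans (count-≟ _≟ₘ_ (deduplicate-! _≟ₘ_ (L.map proj₂ P)) (proj₂ t))
                             (𝟙-yes _ (∈-deduplicate⁺ _≟ₘ_ (∈-map⁺ proj₂ t∈P)))

module _ (p : ℕ) .{{_ : NonZero p}} where

  open Congruence p

  eval≈∑-expansion : ∀ (P : Poly n) (x : Point b n) → eval P x ≈ ∑[ β ∈ expansion p P ] evalMon β x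
  eval≈∑-expansion P x = ≈-sym (begin
    ∑[ β ∈ expansion p P ] F β
      ≡⟨ ∑-expansion p P F ⟩
    ∑[ α ∈ monomials P ] (coeff p P α * F α)
      ≈⟨ ∑-cong-≈ (monomials P) (λ α → *-cong-≈ (%-≈ (rawCoeff P α)) (≈-refl {F α})) ⟩
    ∑[ α ∈ monomials P ] (rawCoeff P α * F α)
      ≡⟨ ∑-monomials-rawCoeff P F ⟩
    eval P x ∎)
    where
    open ≈-Reasoning
    F : Monomial _ → ℕ
    F β = evalMon β x

_≟ₚ_ : DecidableEquality (Point b n)
_≟ₚ_ = ≡-dec Fin._≟_

∑-allPoints-suc : ∀ p n (F : Point p (suc n) → ℕ) →
                  ∑[ x ∈ allPoints p (suc n) ] F x ≡ ∑[ a ∈ allFin p ] ∑[ xs ∈ allPoints p n ] F (a ∷ xs)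
∑-allPoints-suc p n F = trans (∑-concatMap (allFin p) (λ a → L.map (a ∷_) (allPoints p n)) F)
                              (∑-cong (allFin p) (λ a → ∑-map (allPoints p n) (a ∷_) F))

allPoints-enumerates : ∀ p n → Enumerates _≟ₚ_ (allPoints p n)
allPoints-enumerates p zero [] = cong (_+ 0) (𝟙-yes (_≟ₚ_ {p} [] []) refl)
allPoints-enumerates p (suc n) (z ∷ zs) = begin
  count ((z ∷ zs) ≟ₚ_) (allPoints p (suc n))
    ≡⟨ ∑-allPoints-suc p n _ ⟩
  ∑[ a ∈ allFin p ] ∑[ xs ∈ allPoints p n ] 𝟙 ((z ∷ zs) ≟ₚ (a ∷ xs))
    ≡⟨ ∑-cong (allFin p) (λ a → ∑-cong (allPoints p n) (λ xs → 𝟙-∷ a xs)) ⟩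
  ∑[ a ∈ allFin p ] ∑[ xs ∈ allPoints p n ] (𝟙 (z Fin.≟ a) * 𝟙 (zs ≟ₚ xs))
    ≡⟨ ∑-cong (allFin p) (λ a → *-distribˡ-∑ (allPoints p n) (𝟙 (z Fin.≟ a)) (λ xs → 𝟙 (zs ≟ₚ xs))) ⟩
  ∑[ a ∈ allFin p ] (𝟙 (z Fin.≟ a) * count (zs ≟ₚ_) (allPoints p n))
    ≡⟨ ∑-cong (allFin p) (λ a → cong (𝟙 (z Fin.≟ a) *_) (allPoints-enumerates p n zs)) ⟩
  ∑[ a ∈ allFin p ] (𝟙 (z Fin.≟ a) * 1)
    ≡⟨ ∑-cong (allFin p) (λ a → *-identityʳ _) ⟩
  count (z Fin.≟_) (allFin p)
    ≡⟨ trans (count-≟ Fin._≟_ (Uniqueₚ.allFin⁺ p) z) (𝟙-yes _ (∈-allFin z)) ⟩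
  1 ∎
  where
  open ≡-Reasoning
  𝟙-∷ : ∀ a xs → 𝟙 ((z ∷ zs) ≟ₚ (a ∷ xs)) ≡ 𝟙 (z Fin.≟ a) * 𝟙 (zs ≟ₚ xs)
  𝟙-∷ a xs = trans (𝟙-cong _ ((z Fin.≟ a) ×-dec (zs ≟ₚ xs)) (mk⇔ ∷-injective λ (z≡a , zs≡xs) → cong₂ _∷_ z≡a zs≡xs))
                   (𝟙-× (z Fin.≟ a) (zs ≟ₚ xs))

module _ {n} (σ : Permutation′ n) where

  lookup-act : ∀ (x : Point b n) i → lookup (act σ x) i ≡ lookup x (σ ⟨$⟩ˡ i)
  lookup-act x i = lookup∘tabulate (λ j → lookup x (σ ⟨$⟩ˡ j)) i

  lookup-act^k-permPow : ∀ k (x : Point b n) i → lookup (fold x (act σ) k) (permPow σ k i) ≡ lookup x i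
  lookup-act^k-permPow zero x i = refl
  lookup-act^k-permPow (suc k) x i = begin
    lookup (act σ (fold x (act σ) k)) (σ ⟨$⟩ʳ permPow σ k i)
      ≡⟨ lookup-act (fold x (act σ) k) _ ⟩
    lookup (fold x (act σ) k) (σ ⟨$⟩ˡ (σ ⟨$⟩ʳ permPow σ k i))
      ≡⟨ cong (lookup (fold x (act σ) k)) (inverseˡ σ) ⟩
    lookup (fold x (act σ) k) (permPow σ k i)
      ≡⟨ lookup-act^k-permPow k x i ⟩
    lookup x i ∎
    where open ≡-Reasoning

  act^k≡id : ∀ {k} → (∀ i → permPow σ k i ≡ i) → ∀ (x : Point b n) → fold x (act σ) k ≡ x
  act^k≡id {k = k} σ^k≡id x = begin
    fold x (act σ) k
      ≡⟨ tabulate∘lookup _ ⟨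
    tabulate (lookup (fold x (act σ) k))
      ≡⟨ tabulate-cong (λ i → trans (cong (lookup (fold x (act σ) k)) (sym (σ^k≡id i))) (lookup-act^k-permPow k x i)) ⟩
    tabulate (lookup x)
      ≡⟨ tabulate∘lookup x ⟩
    x ∎
    where open ≡-Reasoning

-- The Chevalley–Warning count

∑-evalMon-∷ : ∀ b n e (γ : Monomial n) →
              ∑[ x ∈ allPoints b (suc n) ] evalMon (e ∷ γ) x
              ≡ ∑[ xs ∈ allPoints b n ] evalMon γ xs * powerSum b e
∑-evalMon-∷ b n e γ = begin
  ∑[ x ∈ allPoints b (suc n) ] evalMon (e ∷ γ) x
    ≡⟨ ∑-allPoints-suc b n _ ⟩
  ∑[ a ∈ allFin b ] ∑[ xs ∈ allPoints b n ] (toℕ a ^ e * evalMon γ xs)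
    ≡⟨ ∑-cong (allFin b) (λ a → *-distribˡ-∑ (allPoints b n) (toℕ a ^ e) (evalMon γ)) ⟩
  ∑[ a ∈ allFin b ] (toℕ a ^ e * R)
    ≡⟨ *-distribʳ-∑ (allFin b) R (λ a → toℕ a ^ e) ⟩
  ∑[ a ∈ allFin b ] (toℕ a ^ e) * R
    ≡⟨ cong (_* R) (∑-allFin b (_^ e)) ⟩
  powerSum b e * R
    ≡⟨ *-comm (powerSum b e) R ⟩
  R * powerSum b e ∎
  where
  open ≡-Reasoning
  R = ∑[ xs ∈ allPoints b n ] evalMon γ xs

∑-evalMon-*-∑ : ∀ (xs : List (Point b n)) (γ : Monomial n) (βs : List (Monomial n)) (R : Point b n → ℕ) →
                ∑[ x ∈ xs ] (evalMon γ x * (∑[ β ∈ βs ] evalMon β x * R x))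
                ≡ ∑[ β ∈ βs ] ∑[ x ∈ xs ] (evalMon (zipWith _+_ γ β) x * R x)
∑-evalMon-*-∑ xs γ βs R = begin
  ∑[ x ∈ xs ] (evalMon γ x * (∑[ β ∈ βs ] evalMon β x * R x))
    ≡⟨ ∑-cong xs (λ x → cong (evalMon γ x *_) (*-distribʳ-∑ βs (R x) (λ β → evalMon β x))) ⟨
  ∑[ x ∈ xs ] (evalMon γ x * ∑[ β ∈ βs ] (evalMon β x * R x))
    ≡⟨ ∑-cong xs (λ x → *-distribˡ-∑ βs (evalMon γ x) (λ β → evalMon β x * R x)) ⟨
  ∑[ x ∈ xs ] ∑[ β ∈ βs ] (evalMon γ x * (evalMon β x * R x))
    ≡⟨ ∑-comm xs βs _ ⟩
  ∑[ β ∈ βs ] ∑[ x ∈ xs ] (evalMon γ x * (evalMon β x * R x))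
    ≡⟨ ∑-cong βs (λ β → ∑-cong xs (λ x → *-assoc (evalMon γ x) (evalMon β x) (R x))) ⟨
  ∑[ β ∈ βs ] ∑[ x ∈ xs ] (evalMon γ x * evalMon β x * R x)
    ≡⟨ ∑-cong βs (λ β → ∑-cong xs (λ x → cong (_* R x) (evalMon-zipWith-+ γ β x))) ⟨
  ∑[ β ∈ βs ] ∑[ x ∈ xs ] (evalMon (zipWith _+_ γ β) x * R x) ∎
  where open ≡-Reasoning

∏ : (m : ℕ) → (Fin m → ℕ) → ℕ
∏ zero f = 1
∏ (suc m) f = f Fin.zero * ∏ m (λ i → f (Fin.suc i))

module ChevalleyWarning (q : ℕ) (prime : Prime (2 + q)) where

  open PrimeModulus q prime

  ∏-cong-≈ : ∀ m {f g : Fin m → ℕ} → (∀ i → f i ≈ g i) → ∏ m f ≈ ∏ m g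
  ∏-cong-≈ zero _ = ≈-refl
  ∏-cong-≈ (suc m) f≈g = *-cong-≈ (f≈g Fin.zero) (∏-cong-≈ m (λ i → f≈g (Fin.suc i)))

  CW-root : ∀ (P : Poly n) (x : Point p n) → p ∣ eval P x → eval (CW p P) x ≈ 1
  CW-root P x p∣Px = begin
    eval (CW p P) x                          ≡⟨ eval-CW p P x ⟩
    1 + suc q * (eval P x * eval P x ^ q)    ≈⟨ +-∣-≈ 1 (∣n⇒∣m*n (suc q) (∣m⇒∣m*n (eval P x ^ q) p∣Px)) ⟩
    1                                        ∎
    where open ≈-Reasoning

  CW-nonroot : ∀ (P : Poly n) (x : Point p n) → ¬ p ∣ eval P x → eval (CW p P) x ≈ 0
  CW-nonroot P x p∤Px = begin
    eval (CW p P) x                 ≡⟨ eval-CW p P x ⟩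
    1 + suc q * eval P x ^ suc q    ≈⟨ +-cong-≈ (≈-refl {1}) (*-cong-≈ (≈-refl {suc q}) (fermat-unit p∤Px)) ⟩
    1 + suc q * 1                   ≡⟨ cong suc (*-identityʳ (suc q)) ⟩
    p                               ≈⟨ ∣⇒≈0 ∣-refl ⟩
    0                               ∎
    where open ≈-Reasoning

  𝟙-root≈CW : ∀ (P : Poly n) (x : Point p n) → 𝟙 (p ∣? eval P x) ≈ eval (CW p P) x
  𝟙-root≈CW P x with p ∣? eval P x
  ... | yes p∣Px = ≈-sym (CW-root P x p∣Px)
  ... | no p∤Px = ≈-sym (CW-nonroot P x p∤Px)

  𝟙-V≈∏CW : ∀ {m} (g : Vec (Poly n) m) (x : Point p n) →
            𝟙 (InV? g x) ≈ ∏ m (λ i → eval (CW p (lookup g i)) x)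
  𝟙-V≈∏CW [] x = ≈-refl
  𝟙-V≈∏CW (P ∷ g) x = ≈-trans (≈-reflexive 𝟙-V-∷) (*-cong-≈ (𝟙-root≈CW P x) (𝟙-V≈∏CW g x))
    where
    𝟙-V-∷ : 𝟙 (InV? (P ∷ g) x) ≡ 𝟙 (p ∣? eval P x) * 𝟙 (InV? g x)
    𝟙-V-∷ = trans (𝟙-cong _ ((p ∣? eval P x) ×-dec (InV? g x))
                          (mk⇔ (λ { (h VAll.∷ t) → h , t }) λ (h , t) → h VAll.∷ t))
                  (𝟙-× (p ∣? eval P x) (InV? g x))

  ∑-evalMon-nonMax : ∀ n (γ : Monomial n) → ¬ IsMaxDeg p γ → p ∣ ∑[ x ∈ allPoints p n ] evalMon γ x
  ∑-evalMon-nonMax zero [] γ-nonMax = contradiction VAll.[] γ-nonMax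
  ∑-evalMon-nonMax (suc n) (e ∷ γ) eγ-nonMax = subst (p ∣_) (sym (∑-evalMon-∷ p n e γ)) p∣∑γ*powerSum
    where
    p∣∑γ*powerSum : p ∣ ∑[ xs ∈ allPoints p n ] evalMon γ xs * powerSum p e
    p∣∑γ*powerSum with redExp p e ≟ suc q
    ... | yes e-max =
      ∣m⇒∣m*n (powerSum p e) (∑-evalMon-nonMax n γ (λ γ-max → eγ-nonMax (e-max VAll.∷ γ-max)))
    ... | no e-nonMax = ∣n⇒∣m*n (∑[ xs ∈ allPoints p n ] evalMon γ xs) (p∣powerSum-nonMax e e-nonMax)

  p∣∑-evalMon*∏∑ : ∀ {n} m (T : Fin m → List (Monomial n)) (γ : Monomial n) →
    (∀ (S : (i : Fin m) → Fin (L.length (T i))) → ¬ IsMaxDeg p (zipWith _+_ γ (monProd (λ i → L.lookup (T i) (S i))))) →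
    p ∣ ∑[ x ∈ allPoints p n ] (evalMon γ x * ∏ m (λ i → ∑[ β ∈ T i ] evalMon β x))
  p∣∑-evalMon*∏∑ {n} zero T γ nonMax =
    subst (p ∣_) (∑-cong (allPoints p n) (λ x → sym (*-identityʳ (evalMon γ x))))
      (∑-evalMon-nonMax n γ λ γ-max →
        nonMax (λ ()) (subst (IsMaxDeg p) (sym (zipWith-identityʳ +-identityʳ γ)) γ-max))
  p∣∑-evalMon*∏∑ {n} (suc m) T γ nonMax =
    subst (p ∣_) (sym (∑-evalMon-*-∑ (allPoints p n) γ (T Fin.zero) _))
      (∣-∑ (All.tabulate (λ β∈T₀ → p∣∑-evalMon*∏∑ m (λ i → T (Fin.suc i)) _ (nonMax-γ+β β∈T₀))))
    where
    extend : Fin (L.length (T Fin.zero)) → ((i : Fin m) → Fin (L.length (T (Fin.suc i)))) →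
             (i : Fin (suc m)) → Fin (L.length (T i))
    extend ℓ S Fin.zero = ℓ
    extend ℓ S (Fin.suc i) = S i
    nonMax-γ+β : ∀ {β} (β∈T₀ : β ∈ T Fin.zero) (S : (i : Fin m) → Fin (L.length (T (Fin.suc i)))) →
                 ¬ IsMaxDeg p (zipWith _+_ (zipWith _+_ γ β) (monProd (λ i → L.lookup (T (Fin.suc i)) (S i))))
    nonMax-γ+β β∈T₀ S γβ-max = nonMax (extend (Any.index β∈T₀) S) (subst (IsMaxDeg p) reassoc γβ-max)
      where
      reassoc = trans (zipWith-assoc +-assoc γ _ _)
                      (cong (λ β → zipWith _+_ γ (zipWith _+_ β _)) (lookup-index β∈T₀))

  p∣card-V : ∀ {n m} (g : Vec (Poly n) m) → ¬ M p g → p ∣ card-V p g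
  p∣card-V {n} {m} g M≡∅ = ∣-resp-≈ card≈ (p∣∑-evalMon*∏∑ m T 0ₙ no-max-selection)
    where
    T : Fin m → List (Monomial n)
    T i = expansion p (CW p (lookup g i))
    0ₙ = V.replicate n 0
    no-max-selection : ∀ S → ¬ IsMaxDeg p (zipWith _+_ 0ₙ (monProd (λ i → L.lookup (T i) (S i))))
    no-max-selection S max = M≡∅ (S , subst (IsMaxDeg p) (zipWith-identityˡ +-identityˡ _) max)
    card≈ : card-V p g ≈ ∑[ x ∈ allPoints p n ] (evalMon 0ₙ x * ∏ m (λ i → ∑[ β ∈ T i ] evalMon β x))
    card≈ = begin
      card-V p g
        ≡⟨ length-filter (InV? g) (allPoints p n) ⟩
      count (InV? g) (allPoints p n)
        ≈⟨ ∑-cong-≈ (allPoints p n) (𝟙-V≈∏CW g) ⟩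
      ∑[ x ∈ allPoints p n ] ∏ m (λ i → eval (CW p (lookup g i)) x)
        ≈⟨ ∑-cong-≈ (allPoints p n) (λ x → ∏-cong-≈ m (λ i → eval≈∑-expansion p (CW p (lookup g i)) x)) ⟩
      ∑[ x ∈ allPoints p n ] ∏ m (λ i → ∑[ β ∈ T i ] evalMon β x)
        ≡⟨ ∑-cong (allPoints p n) (λ x → trans (cong (_* ∏ m (λ i → ∑[ β ∈ T i ] evalMon β x)) (evalMon-0 x)) (*-identityˡ _)) ⟨
      ∑[ x ∈ allPoints p n ] (evalMon 0ₙ x * ∏ m (λ i → ∑[ β ∈ T i ] evalMon β x)) ∎
      where open ≈-Reasoning

card-V-++ : ∀ {b n mg mh} (g : Vec (Poly n) mg) (h : Vec (Poly n) mh) →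
            card-V b g ≡ count (λ x → InV? g x ×-dec ¬? (InV? h x)) (allPoints b n) + card-V b (g ++ h)
card-V-++ {b} {n} g h = begin
  card-V b g
    ≡⟨ length-filter (InV? g) (allPoints b n) ⟩
  count (InV? g) (allPoints b n)
    ≡⟨ count-disjoint-∪ (InV? g) W? (InV? (g ++ h)) (mk⇔ split join) disjoint (allPoints b n) ⟩
  count W? (allPoints b n) + count (InV? (g ++ h)) (allPoints b n)
    ≡⟨ cong (count W? (allPoints b n) +_) (length-filter (InV? (g ++ h)) (allPoints b n)) ⟨
  count W? (allPoints b n) + card-V b (g ++ h) ∎
  where
  open ≡-Reasoning
  W? : ∀ (x : Point b n) → Dec (InV g x × ¬ InV h x)
  W? x = InV? g x ×-dec ¬? (InV? h x)
  split : ∀ {x : Point b n} → InV g x → (InV g x × ¬ InV h x) ⊎ InV (g ++ h) x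
  split {x} gx with InV? h x
  ... | yes hx = inj₂ (++⁺ gx hx)
  ... | no ¬hx = inj₁ (gx , ¬hx)
  join : ∀ {x : Point b n} → (InV g x × ¬ InV h x) ⊎ InV (g ++ h) x → InV g x
  join (inj₁ (gx , _)) = gx
  join (inj₂ ghx) = proj₁ (++⁻ g ghx)
  disjoint : ∀ {x : Point b n} → InV g x × ¬ InV h x → ¬ InV (g ++ h) x
  disjoint (_ , ¬hx) ghx = ¬hx (proj₂ (++⁻ g ghx))

theorem4p6 : (p : ℕ) .{{_ : NonZero p}} → Prime p →
    (n mg mh : ℕ) (g : Vec (Poly n) mg) (h : Vec (Poly n) mh) →
    Σ (Permutation′ n) (λ σ → HasOrder σ p × ¬ M p g × ActsFreely {p} σ g h) →
    p ∣ card-V p (g ++ h)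
theorem4p6 zero p-prime = contradiction p-prime ¬prime[0]
theorem4p6 (suc zero) p-prime = contradiction p-prime ¬prime[1]
theorem4p6 p@(suc (suc q)) p-prime n mg mh g h (σ , (σ^p≡id , _) , M≡∅ , free) =
  ∣m+n∣m⇒∣n (subst (p ∣_) (card-V-++ g h) (p∣card-V g M≡∅)) p∣|Vg∖Vh|
  where
  open ChevalleyWarning q p-prime using (p∣card-V)
  open FreeAction _≟ₚ_ {allPoints p n} (allPoints-enumerates p n) p-prime (act σ) (act^k≡id σ {k = p} σ^p≡id)
    using (p∣count-free)
  p∣|Vg∖Vh| = p∣count-free (λ x → InV? g x ×-dec ¬? (InV? h x)) (λ x (gx , ¬hx) → free x gx ¬hx)
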